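{- If $G$ is a $1$-extendable chordal graph and $v$ is a simplicial vertex of $G$, then $G - N[v]$ is $1$-extendable.
   Context: All graphs are finite and simple. A chordal graph is a graph with no induced cycle of length at least four. A vertex $v$ is simplicial if $N(v)$ induces a complete graph; $N[v] = N(v) \cup \{v\}$. A graph is $1$-extendable if every vertex belongs to some maximum independent set. -}

module Defs where

open import Data.Nat using (ℕ; zero; suc; _≤_; _%_)
open import Data.Fin using (Fin; toℕ)
open import Data.Fin.Subset using (Subset; _∈_; _⊆_; ∣_∣; ⊤; inside; outside)
open import Data.Vec using (tabulate)
open import Data.Bool using (Bool; true; false; _∧_; not)
open import Data.Product using (Σ; _×_; ∃)
open import Data.Sum using (_⊎_)
open import Relation.Binary.PropositionalEquality using (_≡_; _≢_)
open import Relation.Nullary using (¬_)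
open import Relation.Nullary.Decidable using (⌊_⌋)
open import Function.Definitions using (Injective)
open import Function.Bundles using (_⇔_)
open import Data.Fin using (_≟_)

record Graph (n : ℕ) : Set where
  field
    adj   : Fin n → Fin n → Bool
    sym   : ∀ x y → adj x y ≡ adj y x
    loopless : ∀ x → adj x x ≡ false
open Graph public

Adjacent : ∀ {n} → Graph n → Fin n → Fin n → Set
Adjacent G x y = adj G x y ≡ true

-- Induced cycle of length k + 4 (i.e. length at least four):
-- an injective map f from Z_{k+4} into V(G) with f i ~ f j iff i, j are
-- consecutive modulo k + 4.
InducedCycle : ∀ {n} → Graph n → (k : ℕ) → (Fin (suc (suc (suc (suc k)))) → Fin n) → Set
InducedCycle {n} G k f =
  Injective _≡_ _≡_ f ×
  (∀ i j → Adjacent G (f i) (f j) ⇔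
     ((suc (toℕ i) % L ≡ toℕ j) ⊎ (suc (toℕ j) % L ≡ toℕ i)))
  where L = suc (suc (suc (suc k)))

Chordal : ∀ {n} → Graph n → Set
Chordal G = ∀ k f → ¬ InducedCycle G k f

Simplicial : ∀ {n} → Graph n → Fin n → Set
Simplicial G v = ∀ u w → Adjacent G v u → Adjacent G v w → u ≢ w → Adjacent G u w

-- Notions for the induced subgraph G[S] on a vertex subset S.
Independent : ∀ {n} → Graph n → Subset n → Subset n → Set
Independent G S I = I ⊆ S × (∀ x y → x ∈ I → y ∈ I → adj G x y ≡ false)

MaximumIndependent : ∀ {n} → Graph n → Subset n → Subset n → Set
MaximumIndependent G S I =
  Independent G S I × (∀ J → Independent G S J → ∣ J ∣ ≤ ∣ I ∣)

OneExtendableOn : ∀ {n} → Graph n → Subset n → Set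
OneExtendableOn G S = ∀ x → x ∈ S → ∃ λ I → MaximumIndependent G S I × x ∈ I

OneExtendable : ∀ {n} → Graph n → Set
OneExtendable G = OneExtendableOn G ⊤

closedNbhdComplement : ∀ {n} → Graph n → Fin n → Subset n
closedNbhdComplement G v =
  tabulate λ x → if (not ⌊ x ≟ v ⌋ ∧ not (adj G v x)) then inside else outside
  where
  open import Data.Bool using (if_then_else_)

{-# OPTIONS --safe #-}
-- A maximum independent set I of G through x meets the clique N[v] in at most
-- one vertex, so I ∖ N[v] is independent in G - N[v], contains x, and has
-- size ≥ |I| - 1. Conversely, adding v to any independent set K of G - N[v]
-- gives an independent set of G, so |K| + 1 ≤ |I|.
module Submission where

open import Defs
open import Data.Nat using (ℕ; suc; _≤_; _<_; s≤s; z≤n)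
open import Data.Nat.Properties using (≤-trans; ≤-pred; module ≤-Reasoning)
open import Data.Fin using (Fin; suc; _≟_)
open import Data.Fin.Properties using (suc-injective)
open import Data.Fin.Subset
  using (Subset; _∈_; _∉_; _⊆_; ∣_∣; ⊤; inside; outside; _∩_; _∪_; ⁅_⁆)
open import Data.Fin.Subset.Properties
  using (∈⊤; x∈p∩q⁺; x∈p∩q⁻; x∈p∪q⁺; x∈p∪q⁻; x∈⁅x⁆; x∈⁅y⁆⇒x≡y;
         p⊆q⇒∣p∣≤∣q∣; p⊂q⇒∣p∣<∣q∣; _∈?_; drop-there; ∣p∣≤∣x∷p∣)
open import Data.Vec using (_∷_; []; here; there)
open import Data.Vec.Properties using ([]=⇒lookup; lookup⇒[]=; lookup∘tabulate)
open import Data.Bool using (false; true; if_then_else_; not; _∧_)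
open import Relation.Nullary.Decidable using (yes; no; ⌊_⌋)
open import Data.Product using (_×_; _,_; proj₁; proj₂)
open import Data.Sum using (_⊎_; inj₁; inj₂)
open import Data.Empty using (⊥-elim)
open import Function using (_∘′_)
open import Relation.Binary.PropositionalEquality
  using (_≡_; _≢_; refl; trans) renaming (sym to ≡-sym)
open import Relation.Nullary.Negation using (contradiction)

private
  variable
    n : ℕ

AtMostOneOutside : Subset n → Subset n → Set
AtMostOneOutside p q = ∀ {x y} → x ∈ p → x ∉ q → y ∈ p → y ∉ q → x ≡ y

AtMostOneOutside-tail : ∀ {a b} {p q : Subset n} →
  AtMostOneOutside (a ∷ p) (b ∷ q) → AtMostOneOutside p q
AtMostOneOutside-tail h x∈p x∉q y∈p y∉q = suc-injective
  (h (there x∈p) (x∉q ∘′ drop-there) (there y∈p) (y∉q ∘′ drop-there))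

AtMostOneOutside⇒∣p∣≤1+∣q∣ : (p q : Subset n) →
  AtMostOneOutside p q → ∣ p ∣ ≤ suc ∣ q ∣
AtMostOneOutside⇒∣p∣≤1+∣q∣ [] [] _ = z≤n
AtMostOneOutside⇒∣p∣≤1+∣q∣ (inside ∷ p) (outside ∷ q) h = s≤s (p⊆q⇒∣p∣≤∣q∣ p⊆q)
  where
  p⊆q : p ⊆ q
  p⊆q {x} x∈p with x ∈? q
  ... | yes x∈q = x∈q
  ... | no x∉q with () ← h (there x∈p) (x∉q ∘′ drop-there) here (λ ())
AtMostOneOutside⇒∣p∣≤1+∣q∣ (inside ∷ p) (inside ∷ q) h =
  s≤s (AtMostOneOutside⇒∣p∣≤1+∣q∣ p q (AtMostOneOutside-tail h))
AtMostOneOutside⇒∣p∣≤1+∣q∣ (outside ∷ p) (b ∷ q) h =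
  ≤-trans (AtMostOneOutside⇒∣p∣≤1+∣q∣ p q (AtMostOneOutside-tail h))
          (s≤s (∣p∣≤∣x∷p∣ b q))

∣p∣<∣p∪⁅x⁆∣ : {p : Subset n} {x : Fin n} → x ∉ p → ∣ p ∣ < ∣ p ∪ ⁅ x ⁆ ∣
∣p∣<∣p∪⁅x⁆∣ {x = x} x∉p =
  p⊂q⇒∣p∣<∣q∣ ((x∈p∪q⁺ ∘′ inj₁) , x , x∈p∪q⁺ (inj₂ (x∈⁅x⁆ x)) , x∉p)

Independent-∩ : (G : Graph n) {T I : Subset n} (S : Subset n) →
  Independent G T I → Independent G S (I ∩ S)
Independent-∩ G {I = I} S (_ , ind) =
  proj₂ ∘′ x∈p∩q⁻ I S ,
  λ x y x∈ y∈ → ind x y (proj₁ (x∈p∩q⁻ I S x∈)) (proj₁ (x∈p∩q⁻ I S y∈))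

InClosedNbhd : Graph n → Fin n → Fin n → Set
InClosedNbhd G v x = x ≡ v ⊎ Adjacent G v x

module _ (G : Graph n) (v : Fin n) where

  private
    S : Subset n
    S = closedNbhdComplement G v

  ∈closedNbhdComplement⁻ : ∀ {x} → x ∈ S → x ≢ v × adj G v x ≡ false
  ∈closedNbhdComplement⁻ {x} x∈S
    with trans (≡-sym (lookup∘tabulate _ x)) ([]=⇒lookup x∈S)
  ... | e with x ≟ v | adj G v x
  ... | no x≢v | false = x≢v , refl
  ... | no _   | true  = contradiction e λ ()
  ... | yes _  | _     = contradiction e λ ()

  ∈closedNbhdComplement⁺ : ∀ {x} → x ≢ v → adj G v x ≡ false → x ∈ S
  ∈closedNbhdComplement⁺ {x} x≢v v≁x =
    lookup⇒[]= x S (trans (lookup∘tabulate _ x) (select (x ≟ v) v≁x))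
    where
    select : ∀ d {b} → b ≡ false →
             (if not ⌊ d ⌋ ∧ not b then inside else outside) ≡ inside
    select (yes x≡v) _ = ⊥-elim (x≢v x≡v)
    select (no _) refl = refl

  v∉closedNbhdComplement : v ∉ S
  v∉closedNbhdComplement v∈S = proj₁ (∈closedNbhdComplement⁻ v∈S) refl

  ∉closedNbhdComplement⇒InClosedNbhd : ∀ {x} → x ∉ S → InClosedNbhd G v x
  ∉closedNbhdComplement⇒InClosedNbhd {x} x∉S with x ≟ v
  ... | yes x≡v = inj₁ x≡v
  ... | no x≢v with adj G v x in v~x
  ... | true  = inj₂ refl
  ... | false = ⊥-elim (x∉S (∈closedNbhdComplement⁺ x≢v v~x))

  Simplicial⇒closedNbhd-clique : Simplicial G v → ∀ {x y} →
    InClosedNbhd G v x → InClosedNbhd G v y → x ≢ y → Adjacent G x y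
  Simplicial⇒closedNbhd-clique _    (inj₁ refl) (inj₁ refl) x≢y = ⊥-elim (x≢y refl)
  Simplicial⇒closedNbhd-clique _    (inj₁ refl) (inj₂ v~y)  _   = v~y
  Simplicial⇒closedNbhd-clique _    (inj₂ v~x)  (inj₁ refl) _   = trans (Graph.sym G _ v) v~x
  Simplicial⇒closedNbhd-clique simp (inj₂ v~x)  (inj₂ v~y)  x≢y = simp _ _ v~x v~y x≢y

  Independent-∩closedNbhd-subsingleton : Simplicial G v → ∀ {T I} →
    Independent G T I → ∀ {x y} →
    x ∈ I → InClosedNbhd G v x → y ∈ I → InClosedNbhd G v y → x ≡ y
  Independent-∩closedNbhd-subsingleton simp (_ , ind) {x} {y} x∈I x∈N y∈I y∈N
    with x ≟ y
  ... | yes x≡y = x≡y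
  ... | no x≢y  = contradiction
    (trans (≡-sym (ind x y x∈I y∈I)) (Simplicial⇒closedNbhd-clique simp x∈N y∈N x≢y))
    λ ()

  Independent-∪⁅v⁆ : ∀ {K} → Independent G S K → Independent G ⊤ (K ∪ ⁅ v ⁆)
  Independent-∪⁅v⁆ {K} (K⊆S , ind) = (λ _ → ∈⊤) , λ x y x∈ y∈ →
    independent x y (x∈p∪q⁻ K ⁅ v ⁆ x∈) (x∈p∪q⁻ K ⁅ v ⁆ y∈)
    where
    v≁ : ∀ {x} → x ∈ K → adj G v x ≡ false
    v≁ = proj₂ ∘′ ∈closedNbhdComplement⁻ ∘′ K⊆S
    independent : ∀ x y → x ∈ K ⊎ x ∈ ⁅ v ⁆ → y ∈ K ⊎ y ∈ ⁅ v ⁆ → adj G x y ≡ false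
    independent x y (inj₁ x∈K) (inj₁ y∈K) = ind x y x∈K y∈K
    independent x y (inj₁ x∈K) (inj₂ y∈⁅v⁆) rewrite x∈⁅y⁆⇒x≡y v y∈⁅v⁆ =
      trans (Graph.sym G x v) (v≁ x∈K)
    independent x y (inj₂ x∈⁅v⁆) (inj₁ y∈K) rewrite x∈⁅y⁆⇒x≡y v x∈⁅v⁆ = v≁ y∈K
    independent x y (inj₂ x∈⁅v⁆) (inj₂ y∈⁅v⁆)
      rewrite x∈⁅y⁆⇒x≡y v x∈⁅v⁆ | x∈⁅y⁆⇒x≡y v y∈⁅v⁆ = Graph.loopless G v

lemma4 : ∀ {n : ℕ} (G : Graph n) (v : Fin n) →
    Chordal G → OneExtendable G → Simplicial G v →
    OneExtendableOn G (closedNbhdComplement G v)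
lemma4 G v _ extendable simplicial x x∈S with extendable x ∈⊤
... | I , (I-independent , I-maximum) , x∈I =
  I ∩ S , (Independent-∩ G S I-independent , I∩S-maximum) , x∈p∩q⁺ (x∈I , x∈S)
  where
  S = closedNbhdComplement G v

  outside-S : ∀ {z} → z ∈ I → z ∉ I ∩ S → InClosedNbhd G v z
  outside-S z∈I z∉I∩S =
    ∉closedNbhdComplement⇒InClosedNbhd G v λ z∈S → z∉I∩S (x∈p∩q⁺ (z∈I , z∈S))

  at-most-one-outside-S : AtMostOneOutside I (I ∩ S)
  at-most-one-outside-S y∈I y∉ z∈I z∉ =
    Independent-∩closedNbhd-subsingleton G v simplicial I-independent
      y∈I (outside-S y∈I y∉) z∈I (outside-S z∈I z∉)

  I∩S-maximum : ∀ K → Independent G S K → ∣ K ∣ ≤ ∣ I ∩ S ∣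
  I∩S-maximum K K-independent = ≤-pred (begin
    suc ∣ K ∣     ≤⟨ ∣p∣<∣p∪⁅x⁆∣ (v∉closedNbhdComplement G v ∘′ proj₁ K-independent) ⟩
    ∣ K ∪ ⁅ v ⁆ ∣ ≤⟨ I-maximum _ (Independent-∪⁅v⁆ G v K-independent) ⟩
    ∣ I ∣         ≤⟨ AtMostOneOutside⇒∣p∣≤1+∣q∣ I (I ∩ S) at-most-one-outside-S ⟩
    suc ∣ I ∩ S ∣ ∎)
    where open ≤-Reasoning
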